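{- Let $G$ and $H$ be two nontrivial connected graphs with orders $m$ and $n$ respectively. Then $$C_{cc}(G\Box H)=\max\{n\cdot C_{cc}(G),\ m\cdot C_{cc}(H)\}.$$
   Context: All graphs are finite, simple and undirected. Cycle convexity on a graph $G$: for $S\subseteq V(G)$, the cycle interval $\langle S\rangle$ is $S$ together with every vertex $w\in V(G)$ that lies on a cycle of the induced subgraph $G[S\cup\{w\}]$ passing through $w$. $S$ is (cycle) convex if $\langle S\rangle=S$. The cycle convexity number $C_{cc}(G)$ is the maximum cardinality of a proper (i.e. $\neq V(G)$) convex subset of $V(G)$. The Cartesian product $G\Box H$ has vertex set $V(G)\times V(H)$, with $(g_1,h_1)\sim(g_2,h_2)$ iff ($g_1\sim g_2$ and $h_1=h_2$) or ($g_1=g_2$ and $h_1\sim h_2$). A graph is nontrivial if it has at least two vertices. -}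

module Defs where

open import Data.Nat using (ℕ; _*_; _≤_; _⊔_)
open import Data.Bool using (Bool; true; false; _∧_; _∨_)
open import Data.Fin using (Fin; remQuot; _≟_)
open import Data.Fin.Subset using (Subset; ⊤; ∣_∣) renaming (_∈_ to _∈ₛ_)
open import Data.List using (List; []; _∷_; _++_; [_]; length)
open import Data.List.Relation.Unary.All using (All)
open import Data.List.Relation.Unary.Linked using (Linked)
open import Data.List.Relation.Unary.Unique.Propositional using (Unique)
open import Data.Product using (Σ; _×_; proj₁; proj₂)
open import Data.Sum using (_⊎_)
open import Relation.Nullary using (¬_)
open import Relation.Nullary.Decidable using (⌊_⌋)
open import Relation.Binary.PropositionalEquality using (_≡_; _≢_)

Adj : ℕ → Set
Adj n = Fin n → Fin n → Bool

Edge : ∀ {n} → Adj n → Fin n → Fin n → Set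
Edge a u v = a u v ≡ true

IsSimple : ∀ {n} → Adj n → Set
IsSimple a = (∀ u v → a u v ≡ a v u) × (∀ u → a u u ≡ false)

data Walk {n} (a : Adj n) : Fin n → Fin n → Set where
  here : ∀ {u} → Walk a u u
  step : ∀ {u v w} → Edge a u v → Walk a v w → Walk a u w

Connected : ∀ {n} → Adj n → Set
Connected {n} a = (u v : Fin n) → Walk a u v

-- Cartesian product G □ H on vertex set Fin (m * n) ≅ Fin m × Fin n
-- (vertex k corresponds to remQuot n k).
_□_ : ∀ {m n} → Adj m → Adj n → Adj (m * n)
_□_ {m} {n} g h x y =
  (g gx gy ∧ ⌊ hx ≟ hy ⌋) ∨ (⌊ gx ≟ gy ⌋ ∧ h hx hy)
  where
  gx = proj₁ (remQuot {m} n x)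
  hx = proj₂ (remQuot {m} n x)
  gy = proj₁ (remQuot {m} n y)
  hy = proj₂ (remQuot {m} n y)

-- w lies on a cycle of G[S ∪ {w}] passing through w: a cycle w, v₁, …, v_k
-- (k ≥ 2, so at least 3 vertices), all vertices distinct, consecutive vertices
-- adjacent and v_k adjacent to w, with v₁, …, v_k ∈ S.
OnCycleThrough : ∀ {n} → Adj n → Subset n → Fin n → Set
OnCycleThrough {n} a S w =
  Σ (List (Fin n)) λ vs →
    (2 ≤ length vs)
    × Unique (w ∷ vs)
    × Linked (Edge a) (w ∷ vs ++ [ w ])
    × All (λ v → v ∈ₛ S) vs

_∈⟨_⟩_ : ∀ {n} → Fin n → Subset n → Adj n → Set
w ∈⟨ S ⟩ a = w ∈ₛ S ⊎ OnCycleThrough a S w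

-- S is cycle convex iff ⟨S⟩ = S (⊇ always holds, so ⟨S⟩ ⊆ S).
Convex : ∀ {n} → Adj n → Subset n → Set
Convex {n} a S = (w : Fin n) → w ∈⟨ S ⟩ a → w ∈ₛ S

IsCcc : ∀ {n} → Adj n → ℕ → Set
IsCcc {n} a k =
  (Σ (Subset n) λ S → Convex a S × S ≢ ⊤ × ∣ S ∣ ≡ k)
  × ((S : Subset n) → Convex a S → S ≢ ⊤ → ∣ S ∣ ≤ k)

{-# OPTIONS --safe #-}
module Submission where

-- If S is convex in G, then S × V(H) is convex in G □ H: a cycle through a vertex
-- (g, h) outside it must leave and re-enter along G-edges to two distinct vertices of
-- S × {h}, and projecting the rest of the cycle to G gives a walk inside S joining two
-- distinct neighbours of g, hence a cycle through g in G[S ∪ {g}]. This yields the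
-- lower bound. Conversely, let S be a proper convex set of G □ H. If S contained a whole
-- G-layer and a whole H-layer, the 4-cycles (g, h) (g′, h) (g′, h′) (g, h′) would
-- propagate membership along the edges of both connected factors until S = V. So either
-- every G-layer meets S in a proper convex set of G, giving |S| ≤ n · C(G), or every
-- H-layer does, giving |S| ≤ m · C(H).

open import Defs
open import Data.Nat using (ℕ; _*_; _≤_; _⊔_; zero; suc; _+_; z≤n; s≤s)
open import Data.Nat.Properties
  using (+-*-semiring; +-assoc; +-mono-≤; ≤-trans; ⊔-sel; m≤m⊔n; m≤n⊔m; module ≤-Reasoning)
open import Algebra.Properties.Semiring.Sum +-*-semiring using (sum; sum-syntax; ∑-comm; sum-cong-≗)
open import Data.Bool using (Bool; true; false; T)
import Data.Bool as Bool
open import Data.Bool.Properties using (T-≡; T-∧; T-∨)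
open import Data.Fin as Fin using (Fin; combine; remQuot; _↑ˡ_; _↑ʳ_)
open import Data.Fin.Properties using (¬∀⟶∃¬; any?; remQuot-combine; combine-remQuot)
open import Data.Fin.Subset using (Subset; ⊤; ∣_∣) renaming (_∈_ to _∈ₛ_; _∉_ to _∉ₛ_)
open import Data.Fin.Subset.Properties using (∈⊤; ⊆⊤; ⊆-antisym) renaming (_∈?_ to _∈ₛ?_)
open import Data.Vec using (lookup; tabulate; []; _∷_)
open import Data.Vec.Properties
  using (≡-dec; lookup∘tabulate; tabulate∘lookup; tabulate-cong; []=⇒lookup; lookup⇒[]=)
open import Data.List using (List; []; _∷_; _++_; [_])
open import Data.List.Membership.Propositional using (_∈_)
open import Data.List.Relation.Unary.All as All using (All; []; _∷_)
open import Data.List.Relation.Unary.AllPairs using ([]; _∷_)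
open import Data.List.Relation.Unary.Any using (here; there)
open import Data.List.Relation.Unary.Linked using (Linked; []; [-]; _∷_)
open import Data.List.Relation.Unary.Unique.Propositional using (Unique)
open import Data.List.Relation.Unary.All.Properties using (¬Any⇒All¬)
open import Data.Product as Product using (Σ; ∃; _×_; _,_; proj₁; proj₂)
open import Data.Sum as Sum using (_⊎_; inj₁; inj₂)
open import Data.Empty using (⊥-elim)
open import Relation.Nullary using (Dec; yes; no)
open import Relation.Nullary.Decidable using (⌊_⌋; toWitness; fromWitness)
open import Relation.Binary.Definitions using (DecidableEquality)
open import Relation.Binary.PropositionalEquality
  using (_≡_; _≢_; refl; sym; trans; cong; cong₂; subst; subst₂; module ≡-Reasoning)
open import Function using (_∘_; _⇔_; mk⇔; Equivalence)
open import Function.Construct.Composition using (_⇔-∘_)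
open import Function.Construct.Symmetry using (⇔-sym)
open import Data.Sum.Function.Propositional using (_⊎-⇔_)
open import Data.Product.Function.NonDependent.Propositional using (_×-⇔_)

infixr 5 _◅_

data Path {A : Set} (R : A → A → Set) : A → List A → A → Set where
  ε   : ∀ {x} → Path R x [] x
  _◅_ : ∀ {x y vs z} → R x y → Path R y vs z → Path R x (y ∷ vs) z

SimplePath : ∀ {A : Set} → (A → A → Set) → A → A → Set
SimplePath R x y = ∃ λ vs → Path R x vs y × Unique (x ∷ vs)

module _ {A : Set} {R : A → A → Set} where

  ε-endpoints : ∀ {x y} → Path R x [] y → x ≡ y
  ε-endpoints ε = refl

  last∈ : ∀ {x v vs y} → Path R x (v ∷ vs) y → y ∈ v ∷ vs
  last∈ (r ◅ ε)       = here refl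
  last∈ (r ◅ r′ ◅ p) = there (last∈ (r′ ◅ p))

  path⇒linked : ∀ {x vs y z} → Path R x vs y → R y z → Linked R (x ∷ vs ++ [ z ])
  path⇒linked ε       r′ = r′ ∷ [-]
  path⇒linked (r ◅ p) r′ = r ∷ path⇒linked p r′

  linked⇒path : ∀ {x z} vs → Linked R (x ∷ vs ++ [ z ]) → ∃ λ y → Path R x vs y × R y z
  linked⇒path []       (r ∷ [-]) = _ , ε , r
  linked⇒path (v ∷ vs) (r ∷ l)   with linked⇒path vs l
  ... | y , p , r′ = y , r ◅ p , r′

  map : ∀ {R′ : A → A → Set} → (∀ {u v} → R u v → R′ u v) →
        ∀ {x vs y} → Path R x vs y → Path R′ x vs y
  map f ε       = ε
  map f (r ◅ p) = f r ◅ map f p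

  targets : ∀ {P : A → Set} → (∀ {u v} → R u v → P v) → ∀ {x vs y} → Path R x vs y → All P vs
  targets f ε       = []
  targets f (r ◅ p) = f r ∷ targets f p

  zipTargets : ∀ {P : A → Set} {x vs y} → Path R x vs y → All P vs → Path (λ u v → R u v × P v) x vs y
  zipTargets ε       []       = ε
  zipTargets (r ◅ p) (v ∷ vs) = (r , v) ◅ zipTargets p vs

  suffix : ∀ {x z vs y} → Path R z vs y → Unique (z ∷ vs) → x ∈ z ∷ vs → SimplePath R x y
  suffix p       u       (here refl) = _ , p , u
  suffix (r ◅ p) (_ ∷ u) (there x∈)  = suffix p u x∈

module _ {A : Set} (_≟_ : DecidableEquality A) {R : A → A → Set} where

  open import Data.List.Membership.DecPropositional _≟_ using (_∈?_)

  simplify : ∀ {x vs y} → Path R x vs y → SimplePath R x y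
  simplify ε = [] , ε , [] ∷ []
  simplify {x} (_◅_ {y = y} r p) with simplify p
  ... | vs , q , u with x ∈? (y ∷ vs)
  ...   | yes x∈ = suffix q u x∈
  ...   | no  x∉ = y ∷ vs , r ◅ q , ¬Any⇒All¬ _ x∉ ∷ u

gmap-weak : ∀ {A B : Set} {R : A → A → Set} {R′ : B → B → Set} (f : A → B) →
            (∀ {u v} → R u v → f u ≡ f v ⊎ R′ (f u) (f v)) →
            ∀ {x vs y} → Path R x vs y → ∃ λ ws → Path R′ (f x) ws (f y)
gmap-weak f weak ε = [] , ε
gmap-weak {R′ = R′} f weak {y = y} (r ◅ p) with weak r | gmap-weak f weak p
... | inj₁ fx≡fz | ws , q = ws , subst (λ z → Path R′ z ws (f y)) (sym fx≡fz) q
... | inj₂ r′    | ws , q = _ , r′ ◅ q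

EdgeInto : ∀ {n} → Adj n → Subset n → Fin n → Fin n → Set
EdgeInto a S u v = Edge a u v × v ∈ₛ S

-- For w ∉ S a detour is the same as a cycle of a[S ∪ {w}] through w, but unlike a
-- cycle it survives maps that collapse edges, such as the projection onto a factor.
record Detour {n} (a : Adj n) (S : Subset n) (w : Fin n) : Set where
  field
    {entry exit} : Fin n
    {route}      : List (Fin n)
    entry∈S      : entry ∈ₛ S
    exit∈S       : exit ∈ₛ S
    entry≢exit   : entry ≢ exit
    enter        : Edge a w entry
    leave        : Edge a exit w
    path         : Path (EdgeInto a S) entry route exit

module _ {n} {a : Adj n} {S : Subset n} where

  onCycle⇒detour : ∀ {w} → OnCycleThrough a S w → Detour a S w
  onCycle⇒detour (_ ∷ [] , s≤s () , _)
  onCycle⇒detour (v ∷ v′ ∷ vs , _ , (_ ∷ v∉vs ∷ _) , enter ∷ l , v∈S ∷ v′∈S ∷ vs⊆S)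
    with linked⇒path (v′ ∷ vs) l
  ... | _ , p , leave = record
    { entry∈S    = v∈S
    ; exit∈S     = All.lookup (v′∈S ∷ vs⊆S) (last∈ p)
    ; entry≢exit = All.lookup v∉vs (last∈ p)
    ; enter      = enter
    ; leave      = leave
    ; path       = zipTargets p (v′∈S ∷ vs⊆S)
    }

  detour⇒onCycle : ∀ {w} → w ∉ₛ S → Detour a S w → OnCycleThrough a S w
  detour⇒onCycle {w} w∉S d with simplify Fin._≟_ (Detour.path d)
  ... | []     , p , _      = ⊥-elim (Detour.entry≢exit d (ε-endpoints p))
  ... | q ∷ qs , p , unique =
    entry ∷ q ∷ qs , s≤s (s≤s z≤n) , All.map w≢ cycle⊆S ∷ unique ,
    enter ∷ path⇒linked (map proj₁ p) leave , cycle⊆S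
    where
    open Detour d
    cycle⊆S : All (_∈ₛ S) (entry ∷ q ∷ qs)
    cycle⊆S = entry∈S ∷ targets proj₂ p
    w≢ : ∀ {v} → v ∈ₛ S → w ≢ v
    w≢ v∈S refl = w∉S v∈S

  convex-by-detours : (∀ {w} → w ∉ₛ S → Detour a S w → w ∈ₛ S) → Convex a S
  convex-by-detours closed w (inj₁ w∈S) = w∈S
  convex-by-detours closed w (inj₂ cycle) with w ∈ₛ? S
  ... | yes w∈S = w∈S
  ... | no  w∉S = closed w∉S (onCycle⇒detour cycle)

  detour-closed : Convex a S → ∀ {w} → Detour a S w → w ∈ₛ S
  detour-closed convex {w} d with w ∈ₛ? S
  ... | yes w∈S = w∈S
  ... | no  w∉S = convex w (inj₂ (detour⇒onCycle w∉S d))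

module _ {k : ℕ} where

  _≟ₛ_ : DecidableEquality (Subset k)
  _≟ₛ_ = ≡-dec Bool._≟_

  full⇒≡⊤ : {S : Subset k} → (∀ x → x ∈ₛ S) → S ≡ ⊤
  full⇒≡⊤ full = ⊆-antisym ⊆⊤ (λ {x} _ → full x)

  ≡⊤⇒full : {S : Subset k} → S ≡ ⊤ → ∀ x → x ∈ₛ S
  ≡⊤⇒full refl x = ∈⊤

  ≢⊤⇒∃∉ : {S : Subset k} → S ≢ ⊤ → ∃ (_∉ₛ S)
  ≢⊤⇒∃∉ {S} S≢⊤ = ¬∀⟶∃¬ k (_∈ₛ S) (_∈ₛ? S) (S≢⊤ ∘ full⇒≡⊤)

module _ {k} {a : Adj k} (simple : IsSimple a) where

  edge-sym : ∀ {u v} → Edge a u v → Edge a v u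
  edge-sym {u} {v} e = trans (proj₁ simple v u) e

  edge⇒≢ : ∀ {u v} → Edge a u v → u ≢ v
  edge⇒≢ {u} e refl with trans (sym e) (proj₂ simple u)
  ... | ()

ProperConvexOfSize : ∀ {k} → Adj k → ℕ → Set
ProperConvexOfSize {k} a c = Σ (Subset k) λ S → Convex a S × S ≢ ⊤ × ∣ S ∣ ≡ c

vertex-outside : ∀ {k} {a : Adj k} {c} → ProperConvexOfSize a c → Fin k
vertex-outside (_ , _ , S≢⊤ , _) = proj₁ (≢⊤⇒∃∉ S≢⊤)

preimage : ∀ {k l} → (Fin k → Fin l) → Subset l → Subset k
preimage f S = tabulate (lookup S ∘ f)

module _ {k l} {f : Fin k → Fin l} {S : Subset l} {x : Fin k} where

  ∈-preimage⁺ : f x ∈ₛ S → x ∈ₛ preimage f S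
  ∈-preimage⁺ fx∈S = lookup⇒[]= x _ (trans (lookup∘tabulate (lookup S ∘ f) x) ([]=⇒lookup fx∈S))

  ∈-preimage⁻ : x ∈ₛ preimage f S → f x ∈ₛ S
  ∈-preimage⁻ x∈ = lookup⇒[]= (f x) S (trans (sym (lookup∘tabulate (lookup S ∘ f) x)) ([]=⇒lookup x∈))

indicator : Bool → ℕ
indicator true  = 1
indicator false = 0

∣∣≡∑ : ∀ {k} (S : Subset k) → ∣ S ∣ ≡ ∑[ x < k ] indicator (lookup S x)
∣∣≡∑ []          = refl
∣∣≡∑ (true  ∷ S) = cong suc (∣∣≡∑ S)
∣∣≡∑ (false ∷ S) = ∣∣≡∑ S

sum-mono-≤ : ∀ {k} {f g : Fin k → ℕ} → (∀ i → f i ≤ g i) → sum f ≤ sum g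
sum-mono-≤ {zero}  f≤g = z≤n
sum-mono-≤ {suc k} f≤g = +-mono-≤ (f≤g Fin.zero) (sum-mono-≤ (f≤g ∘ Fin.suc))

∑-const : ∀ k c → ∑[ i < k ] c ≡ k * c
∑-const zero    c = refl
∑-const (suc k) c = cong (c +_) (∑-const k c)

∑-↑ : ∀ a {b} (f : Fin (a + b) → ℕ) → sum f ≡ ∑[ i < a ] f (i ↑ˡ b) + ∑[ j < b ] f (a ↑ʳ j)
∑-↑ zero    f = refl
∑-↑ (suc a) f = trans (cong (f Fin.zero +_) (∑-↑ a (f ∘ Fin.suc))) (sym (+-assoc (f Fin.zero) _ _))

∑-combine : ∀ m {n} (f : Fin (m * n) → ℕ) → sum f ≡ ∑[ g < m ] ∑[ h < n ] f (combine g h)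
∑-combine zero        f = refl
∑-combine (suc m) {n} f =
  trans (∑-↑ n f) (cong (sum (λ h → f (h ↑ˡ (m * n))) +_) (∑-combine m (f ∘ (n ↑ʳ_))))

record IsCartesianProduct {N m n} (A : Adj N) (G : Adj m) (H : Adj n) : Set where
  field
    pair         : Fin m → Fin n → Fin N
    fst          : Fin N → Fin m
    snd          : Fin N → Fin n
    fst-pair     : ∀ g h → fst (pair g h) ≡ g
    snd-pair     : ∀ g h → snd (pair g h) ≡ h
    pair-fst-snd : ∀ x → pair (fst x) (snd x) ≡ x
    edge⇔        : ∀ {x y} → Edge A x y ⇔
                     (Edge G (fst x) (fst y) × snd x ≡ snd y ⊎ fst x ≡ fst y × Edge H (snd x) (snd y))
    -- follows from pair being a bijection, but is easier to supply per instance
    sum-pair     : ∀ (f : Fin N → ℕ) → sum f ≡ ∑[ g < m ] ∑[ h < n ] f (pair g h)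

transpose : ∀ {N m n} {A : Adj N} {G : Adj m} {H : Adj n} →
            IsCartesianProduct A G H → IsCartesianProduct A H G
transpose P = record
  { pair         = λ h g → pair g h
  ; fst          = snd
  ; snd          = fst
  ; fst-pair     = λ h g → snd-pair g h
  ; snd-pair     = λ h g → fst-pair g h
  ; pair-fst-snd = pair-fst-snd
  ; edge⇔        = mk⇔ (flip-edge ∘ Equivalence.to edge⇔) (Equivalence.from edge⇔ ∘ flip-edge)
  ; sum-pair     = λ f → trans (sum-pair f) (∑-comm (λ g h → f (pair g h)))
  }
  where
  open IsCartesianProduct P
  flip-edge : ∀ {P Q P′ Q′ : Set} → P × Q ⊎ P′ × Q′ → Q′ × P′ ⊎ Q × P
  flip-edge = Sum.swap ∘ Sum.map Product.swap Product.swap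

module CartesianProduct {N m n} {A : Adj N} {G : Adj m} {H : Adj n}
                        (P : IsCartesianProduct A G H) where

  open IsCartesianProduct P

  ≡-by-coordinates : ∀ {x y} → fst x ≡ fst y → snd x ≡ snd y → x ≡ y
  ≡-by-coordinates {x} {y} p q = trans (sym (pair-fst-snd x)) (trans (cong₂ pair p q) (pair-fst-snd y))

  pair-injectiveˡ : ∀ {g g′ h h′} → pair g h ≡ pair g′ h′ → g ≡ g′
  pair-injectiveˡ {g} {g′} {h} {h′} eq = trans (sym (fst-pair g h)) (trans (cong fst eq) (fst-pair g′ h′))

  edge-fst : ∀ {g g′} h → Edge G g g′ → Edge A (pair g h) (pair g′ h)
  edge-fst {g} {g′} h e = Equivalence.from edge⇔ (inj₁
    (subst₂ (Edge G) (sym (fst-pair g h)) (sym (fst-pair g′ h)) e , trans (snd-pair g h) (sym (snd-pair g′ h))))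

  edge-snd : ∀ g {h h′} → Edge H h h′ → Edge A (pair g h) (pair g h′)
  edge-snd g {h} {h′} e = Equivalence.from edge⇔ (inj₂
    (trans (fst-pair g h) (sym (fst-pair g h′)) , subst₂ (Edge H) (sym (snd-pair g h)) (sym (snd-pair g h′)) e))

  edge-across-fst : ∀ {x y} → Edge A x y → fst x ≢ fst y → Edge G (fst x) (fst y) × snd x ≡ snd y
  edge-across-fst e fx≢fy with Equivalence.to edge⇔ e
  ... | inj₁ horizontal = horizontal
  ... | inj₂ (fx≡fy , _) = ⊥-elim (fx≢fy fx≡fy)

  cylinder : Subset m → Subset N
  cylinder = preimage fst

  layer : Subset N → Fin n → Subset m
  layer S h = preimage (λ g → pair g h) S

  module _ {S : Subset m} where

    project-detour : ∀ {w} → fst w ∉ₛ S → Detour A (cylinder S) w → Detour G S (fst w)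
    project-detour {w} fw∉S d = record
      { entry∈S    = ∈-preimage⁻ entry∈S
      ; exit∈S     = ∈-preimage⁻ exit∈S
      ; entry≢exit = λ eq → entry≢exit (≡-by-coordinates eq (trans (sym (proj₂ enter′)) (sym (proj₂ leave′))))
      ; enter      = proj₁ enter′
      ; leave      = proj₁ leave′
      ; path       = proj₂ (gmap-weak fst project-step path)
      }
      where
      open Detour d
      enter′ : Edge G (fst w) (fst entry) × snd w ≡ snd entry
      enter′ = edge-across-fst enter λ eq → fw∉S (subst (_∈ₛ S) (sym eq) (∈-preimage⁻ entry∈S))
      leave′ : Edge G (fst exit) (fst w) × snd exit ≡ snd w
      leave′ = edge-across-fst leave λ eq → fw∉S (subst (_∈ₛ S) eq (∈-preimage⁻ exit∈S))
      project-step : ∀ {x y} → EdgeInto A (cylinder S) x y → fst x ≡ fst y ⊎ EdgeInto G S (fst x) (fst y)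
      project-step (e , y∈) with Equivalence.to edge⇔ e
      ... | inj₁ (e′ , _)     = inj₂ (e′ , ∈-preimage⁻ y∈)
      ... | inj₂ (fx≡fy , _) = inj₁ fx≡fy

    cylinder-convex : Convex G S → Convex A (cylinder S)
    cylinder-convex convex = convex-by-detours λ w∉ d →
      ∈-preimage⁺ (detour-closed convex (project-detour (w∉ ∘ ∈-preimage⁺) d))

    cylinder-proper : Fin n → S ≢ ⊤ → cylinder S ≢ ⊤
    cylinder-proper h S≢⊤ cylinder≡⊤ = S≢⊤ (full⇒≡⊤ λ g →
      subst (_∈ₛ S) (fst-pair g h) (∈-preimage⁻ (≡⊤⇒full cylinder≡⊤ (pair g h))))

  module _ {S : Subset N} {h : Fin n} where

    lift-detour : ∀ {g} → Detour G (layer S h) g → Detour A S (pair g h)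
    lift-detour d = record
      { entry∈S    = ∈-preimage⁻ entry∈S
      ; exit∈S     = ∈-preimage⁻ exit∈S
      ; entry≢exit = entry≢exit ∘ pair-injectiveˡ
      ; enter      = edge-fst h enter
      ; leave      = edge-fst h leave
      ; path       = proj₂ (gmap-weak (λ g → pair g h) lift-step path)
      }
      where
      open Detour d
      lift-step : ∀ {u v} → EdgeInto G (layer S h) u v →
                  pair u h ≡ pair v h ⊎ EdgeInto A S (pair u h) (pair v h)
      lift-step (e , v∈) = inj₂ (edge-fst h e , ∈-preimage⁻ v∈)

    layer-convex : Convex A S → Convex G (layer S h)
    layer-convex convex = convex-by-detours λ _ d → ∈-preimage⁺ (detour-closed convex (lift-detour d))

  ∣∣≡∑∣layer∣ : ∀ S → ∣ S ∣ ≡ ∑[ h < n ] ∣ layer S h ∣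
  ∣∣≡∑∣layer∣ S = begin
    ∣ S ∣                              ≡⟨ ∣∣≡∑ S ⟩
    ∑[ x < N ] indicator (lookup S x)  ≡⟨ sum-pair _ ⟩
    ∑[ g < m ] ∑[ h < n ] χ g h        ≡⟨ ∑-comm χ ⟩
    ∑[ h < n ] ∑[ g < m ] χ g h        ≡⟨ sum-cong-≗ (sym ∘ ∣layer∣≡∑) ⟩
    ∑[ h < n ] ∣ layer S h ∣           ∎
    where
    open ≡-Reasoning
    χ : Fin m → Fin n → ℕ
    χ g h = indicator (lookup S (pair g h))
    ∣layer∣≡∑ : ∀ h → ∣ layer S h ∣ ≡ ∑[ g < m ] χ g h
    ∣layer∣≡∑ h = trans (∣∣≡∑ (layer S h))
      (sum-cong-≗ λ g → cong indicator (lookup∘tabulate (lookup S ∘ λ g → pair g h) g))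

  layer-cylinder : ∀ S h → layer (cylinder S) h ≡ S
  layer-cylinder S h = trans
    (tabulate-cong λ g → trans (lookup∘tabulate (lookup S ∘ fst) (pair g h)) (cong (lookup S) (fst-pair g h)))
    (tabulate∘lookup S)

  ∣cylinder∣ : ∀ S → ∣ cylinder S ∣ ≡ n * ∣ S ∣
  ∣cylinder∣ S = trans (∣∣≡∑∣layer∣ (cylinder S))
    (trans (sum-cong-≗ λ h → cong ∣_∣ (layer-cylinder S h)) (∑-const n ∣ S ∣))

  cylinder-witness : ∀ {c} → Fin n → ProperConvexOfSize G c → ProperConvexOfSize A (n * c)
  cylinder-witness h (S , convex , S≢⊤ , ∣S∣≡c) =
    cylinder S , cylinder-convex convex , cylinder-proper h S≢⊤ ,
    trans (∣cylinder∣ S) (cong (n *_) ∣S∣≡c)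

  proper-layers⇒∣∣≤ : ∀ {p S} → IsCcc G p → Convex A S → (∀ h → layer S h ≢ ⊤) → ∣ S ∣ ≤ n * p
  proper-layers⇒∣∣≤ {p} {S} (_ , maximal) convex proper = begin
    ∣ S ∣                     ≡⟨ ∣∣≡∑∣layer∣ S ⟩
    ∑[ h < n ] ∣ layer S h ∣  ≤⟨ sum-mono-≤ (λ h → maximal _ (layer-convex convex) (proper h)) ⟩
    ∑[ h < n ] p              ≡⟨ ∑-const n p ⟩
    n * p                     ∎
    where open ≤-Reasoning

  module _ (simpleG : IsSimple G) (simpleH : IsSimple H) {S : Subset N} (convex : Convex A S) where

    square : ∀ {g g′ h h′} → Edge G g g′ → Edge H h h′ →
             pair g h ∈ₛ S → pair g h′ ∈ₛ S → pair g′ h ∈ₛ S → pair g′ h′ ∈ₛ S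
    square {g} {g′} {h} {h′} eG eH gh∈S gh′∈S g′h∈S = detour-closed convex (record
      { entry∈S    = gh′∈S
      ; exit∈S     = g′h∈S
      ; entry≢exit = edge⇒≢ simpleG eG ∘ pair-injectiveˡ
      ; enter      = edge-fst h′ (edge-sym simpleG eG)
      ; leave      = edge-snd g′ eH
      ; path       = (edge-snd g (edge-sym simpleH eH) , gh∈S) ◅ (edge-fst h eG , g′h∈S) ◅ ε
      })

    column-spread : ∀ {g g′} → (∀ h → pair g h ∈ₛ S) → Edge G g g′ →
                    ∀ {h h′} → Walk H h h′ → pair g′ h ∈ₛ S → pair g′ h′ ∈ₛ S
    column-spread column eG here          g′h∈S = g′h∈S
    column-spread column eG (step eH walk) g′h∈S =
      column-spread column eG walk (square eG eH (column _) (column _) g′h∈S)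

    columns-spread : ∀ {h₀} → (∀ g → pair g h₀ ∈ₛ S) → (∀ h → Walk H h₀ h) →
                     ∀ {g g′} → Walk G g g′ → (∀ h → pair g h ∈ₛ S) → ∀ h → pair g′ h ∈ₛ S
    columns-spread row walks here          column = column
    columns-spread row walks (step eG walk) column =
      columns-spread row walks walk (λ h → column-spread column eG (walks h) (row _))

    full-row-and-column⇒≡⊤ : Connected G → Connected H → ∀ {g₀ h₀} →
                             (∀ g → pair g h₀ ∈ₛ S) → (∀ h → pair g₀ h ∈ₛ S) → S ≡ ⊤
    full-row-and-column⇒≡⊤ connectedG connectedH {g₀} {h₀} row column = full⇒≡⊤ λ x →
      subst (_∈ₛ S) (pair-fst-snd x)
        (columns-spread row (connectedH h₀) (connectedG g₀ (fst x)) column (snd x))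

module _ {N m n} {A : Adj N} {G : Adj m} {H : Adj n} (P : IsCartesianProduct A G H)
         (simpleG : IsSimple G) (simpleH : IsSimple H) (connectedG : Connected G) (connectedH : Connected H) where

  private
    module Rows    = CartesianProduct P
    module Columns = CartesianProduct (transpose P)

  proper-convex⇒proper-rows-or-columns : ∀ {S} → Convex A S → S ≢ ⊤ →
    (∀ h → Rows.layer S h ≢ ⊤) ⊎ (∀ g → Columns.layer S g ≢ ⊤)
  proper-convex⇒proper-rows-or-columns {S} convex S≢⊤
    with any? (λ h → Rows.layer S h ≟ₛ ⊤) | any? (λ g → Columns.layer S g ≟ₛ ⊤)
  ... | no ¬full-row | _ = inj₁ λ h full → ¬full-row (h , full)
  ... | _ | no ¬full-column = inj₂ λ g full → ¬full-column (g , full)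
  ... | yes (h₀ , full-row) | yes (g₀ , full-column) = ⊥-elim (S≢⊤
    (Rows.full-row-and-column⇒≡⊤ simpleG simpleH convex connectedG connectedH
      (∈-preimage⁻ ∘ ≡⊤⇒full full-row) (∈-preimage⁻ ∘ ≡⊤⇒full full-column)))

  isCcc-cartesianProduct : ∀ {p q} → IsCcc G p → IsCcc H q → IsCcc A (n * p ⊔ m * q)
  isCcc-cartesianProduct {p} {q} ccG@(witnessG , _) ccH@(witnessH , _) = largest , bounded
    where
    largest : ProperConvexOfSize A (n * p ⊔ m * q)
    largest with ⊔-sel (n * p) (m * q)
    ... | inj₁ eq = subst (ProperConvexOfSize A) (sym eq)
                      (Rows.cylinder-witness (vertex-outside witnessH) witnessG)
    ... | inj₂ eq = subst (ProperConvexOfSize A) (sym eq)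
                      (Columns.cylinder-witness (vertex-outside witnessG) witnessH)
    bounded : ∀ S → Convex A S → S ≢ ⊤ → ∣ S ∣ ≤ n * p ⊔ m * q
    bounded S convex S≢⊤ with proper-convex⇒proper-rows-or-columns convex S≢⊤
    ... | inj₁ rows    = ≤-trans (Rows.proper-layers⇒∣∣≤ ccG convex rows) (m≤m⊔n _ _)
    ... | inj₂ columns = ≤-trans (Columns.proper-layers⇒∣∣≤ ccH convex columns) (m≤n⊔m _ _)

module _ {m n} (G : Adj m) (H : Adj n) where

  private
    π₁ : Fin (m * n) → Fin m
    π₁ x = proj₁ (remQuot {m} n x)
    π₂ : Fin (m * n) → Fin n
    π₂ x = proj₂ (remQuot {m} n x)

  □-edge⇔ : ∀ {x y} → Edge (G □ H) x y ⇔
    (Edge G (π₁ x) (π₁ y) × π₂ x ≡ π₂ y ⊎ π₁ x ≡ π₁ y × Edge H (π₂ x) (π₂ y))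
  □-edge⇔ = ((T-≡ ×-⇔ T-⌊⌋) ⇔-∘ T-∧ ⊎-⇔ (T-⌊⌋ ×-⇔ T-≡) ⇔-∘ T-∧)
        ⇔-∘ (T-∨ ⇔-∘ ⇔-sym T-≡)
    where
    T-⌊⌋ : ∀ {P : Set} {d : Dec P} → T ⌊ d ⌋ ⇔ P
    T-⌊⌋ = mk⇔ toWitness fromWitness

  □-isCartesianProduct : IsCartesianProduct (G □ H) G H
  □-isCartesianProduct = record
    { pair         = combine
    ; fst          = π₁
    ; snd          = π₂
    ; fst-pair     = λ g h → cong proj₁ (remQuot-combine g h)
    ; snd-pair     = λ g h → cong proj₂ (remQuot-combine g h)
    ; pair-fst-snd = combine-remQuot {m} n
    ; edge⇔        = □-edge⇔
    ; sum-pair     = ∑-combine m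
    }

mainTheorem8 : ∀ {m n} (G : Adj m) (H : Adj n) →
    IsSimple G → IsSimple H → 2 ≤ m → 2 ≤ n →
    Connected G → Connected H →
    (p q : ℕ) → IsCcc G p → IsCcc H q →
    IsCcc (G □ H) ((n * p) ⊔ (m * q))
mainTheorem8 G H simpleG simpleH _ _ connectedG connectedH _ _ =
  isCcc-cartesianProduct (□-isCartesianProduct G H) simpleG simpleH connectedG connectedH
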